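{- Let $S^{\bot C}$ be a consistent atomic system such that for every $p\in\mathsf{At}_\bot$ either $\vdash_{S^{\bot C}}p$ or $p\vdash_{S^{\bot C}}\bot$. Then for every atomic system $S'\supseteq S^{\bot C}$ and every ecumenical formula $A$, $\Vdash^L_{S^{\bot C}}A$ if and only if $\Vdash^L_{S'}A$.
   Context: Basic setting. Let $\mathsf{At}$ be a countably infinite set of atomic propositions and $\mathsf{At}_\bot=\mathsf{At}\cup\{\bot\}$. An atomic rule has the form "from premises $p_1,\dots,p_n$ ($n\ge 0$) infer $p$", with $p_j,p\in\mathsf{At}_\bot$, where the derivation of each premise may discharge a set of basic sentences. An atomic system $S$ is a set of atomic rules; $S\subseteq S'$ ($S'$ extends $S$) if $S'$ contains all rules of $S$. $\Delta\vdash_S p$ means there is a natural-deduction derivation using only rules of $S$ with conclusion $p$ and undischarged assumptions in $\Delta$ (so $p\vdash_S p$). $S$ is consistent if $\nvdash_S\bot$. Standing convention: all atomic systems (including all extensions quantified over) are required to be consistent. Ecumenical formulas: $p^i,p^c$ for $p\in\mathsf{At}_\bot$; $(A\wedge B)^x,(A\vee B)^x,(A\to B)^x$ for $x\in\{i,c\}$. In semantic statements $\bot$ denotes $\bot^i$; for $X^c$, $X^i$ is the same construction with outer superscript $i$. Weak validity (by simultaneous recursion): (1) $\Vdash^L_S p^i$ iff $\vdash_S p$ ($p\in\mathsf{At}_\bot$); (2) $\Vdash^L_S p^c$ iff $p\nvdash_S\bot$; (3) for non-atomic $X$, $\Vdash^L_S X^c$ iff $X^i\nVdash^L_S\bot$;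 (4) $\Vdash^L_S(A\wedge B)^i$ iff $\Vdash^L_S A$ and $\Vdash^L_S B$; (5) $\Vdash^L_S(A\to B)^i$ iff $A\Vdash^G_S B$; (6) $\Vdash^L_S(A\vee B)^i$ iff for all $S'\supseteq S$ and all $p\in\mathsf{At}_\bot$, if $A\Vdash^L_{S'}p^i$ and $B\Vdash^L_{S'}p^i$ then $\Vdash^L_{S'}p^i$; (7) for nonempty $\Gamma$, $\Gamma\Vdash^L_S A$ iff for all $S'\supseteq S$, if $\Vdash^L_{S'}B$ for all $B\in\Gamma$ then $\Vdash^L_{S'}A$; (8) $\Gamma\Vdash^G_S A$ iff for all $S'\supseteq S$: if $\Vdash^L_{S''}B$ for all $B\in\Gamma$ and all $S''\supseteq S'$, then $\Vdash^L_{S''}A$ for all $S''\supseteq S'$. -}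

module Defs where

open import Data.Nat using (ℕ)
open import Data.List using (List; []; _∷_; _++_)
open import Data.List.Membership.Propositional using (_∈_)
open import Data.List.Relation.Unary.All using (All)
open import Data.Product using (_×_; _,_)
open import Relation.Nullary using (¬_)
import Data.Empty

data At⊥ : Set where
  atom : ℕ → At⊥
  ⊥ₐ   : At⊥

-- An atomic rule: premises (each with the finite set of basic sentences
-- its derivation may discharge) and a conclusion.
record Rule : Set where
  constructor mkRule
  field
    premises   : List (List At⊥ × At⊥)
    conclusion : At⊥
open Rule public

System : Set₁
System = Rule → Set

_⊑_ : System → System → Set
S ⊑ S' = ∀ r → S r → S' r

data Deriv (S : System) : List At⊥ → At⊥ → Set where
  hyp  : ∀ {Δ p} → p ∈ Δ → Deriv S Δ p
  rule : ∀ {Δ} (r : Rule) → S r →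
         All (λ prem → Deriv S (Data.Product.proj₁ prem ++ Δ) (Data.Product.proj₂ prem)) (premises r) →
         Deriv S Δ (conclusion r)

Consistent : System → Set
Consistent S = ¬ Deriv S [] ⊥ₐ

data Flag : Set where
  i c : Flag

data Form : Set where
  at   : Flag → At⊥ → Form
  conj : Flag → Form → Form → Form
  disj : Flag → Form → Form → Form
  imp  : Flag → Form → Form → Form

-- ⊥ (= ⊥^i) in semantic statements
⊥ⁱ : Form
⊥ⁱ = at i ⊥ₐ

AllExt : System → (System → Set₁) → Set₁
AllExt S P = ∀ S' → S ⊑ S' → Consistent S' → P S'

mutual
  ⊩ˡ : System → Form → Set₁
  ⊩ˡ S (at i p) = Lift1 (Deriv S [] p)
  ⊩ˡ S (at c p) = Lift1 (¬ Deriv S (p ∷ []) ⊥ₐ)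
  ⊩ˡ S (conj i A B) = ⊩∧ S A B
  ⊩ˡ S (disj i A B) = ⊩∨ S A B
  ⊩ˡ S (imp i A B)  = ⊩→ S A B
  -- clause (3): X^c valid iff X^i ⊮^L_S ⊥
  ⊩ˡ S (conj c A B) = ¬₁ (AllExt S (λ S' → ⊩∧ S' A B → ⊩ˡ S' ⊥ⁱ))
  ⊩ˡ S (disj c A B) = ¬₁ (AllExt S (λ S' → ⊩∨ S' A B → ⊩ˡ S' ⊥ⁱ))
  ⊩ˡ S (imp c A B)  = ¬₁ (AllExt S (λ S' → ⊩→ S' A B → ⊩ˡ S' ⊥ⁱ))

  ⊩∧ : System → Form → Form → Set₁
  ⊩∧ S A B = ⊩ˡ S A × ⊩ˡ S B

  -- (6), with A ⊩^L_{S'} p^i unfolded by (7)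
  ⊩∨ : System → Form → Form → Set₁
  ⊩∨ S A B = AllExt S (λ S' → ∀ p →
               AllExt S' (λ S'' → ⊩ˡ S'' A → ⊩ˡ S'' (at i p)) →
               AllExt S' (λ S'' → ⊩ˡ S'' B → ⊩ˡ S'' (at i p)) →
               ⊩ˡ S' (at i p))

  -- (5), with A ⊩^G_S B unfolded by (8)
  ⊩→ : System → Form → Form → Set₁
  ⊩→ S A B = AllExt S (λ S' →
               AllExt S' (λ S'' → ⊩ˡ S'' A) →
               AllExt S' (λ S'' → ⊩ˡ S'' B))

  record Lift1 (X : Set) : Set₁ where
    constructor lift1
    field lower1 : X

  ¬₁ : Set₁ → Set₁
  ¬₁ X = X → Lift1 (Data.Empty.⊥)

-- A complete system S already decides every atom: either p is derivable or
-- p refutes itself.  A consistent extension can therefore neither derive a new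
-- atom nor refute an atom S leaves unrefuted, so all extensions agree with S on
-- the atomic clauses.  The remaining clauses of weak validity only quantify over
-- consistent extensions, and by induction on the formula every consistent
-- extension of S (hence every extension of an extension) validates exactly what
-- S validates.
module Submission where

open import Defs
open import Data.List using (List; []; _∷_; _++_)
open import Data.List.Membership.Propositional using (_∈_)
open import Data.List.Membership.Propositional.Properties using (∈-++⁺ˡ; ∈-++⁻)
open import Data.List.Relation.Binary.Subset.Propositional using (_⊆_)
open import Data.List.Relation.Binary.Subset.Propositional.Properties
  using (++⁺ʳ; xs⊆ys++xs)
open import Data.List.Relation.Unary.All using (All; []; _∷_)
open import Data.List.Relation.Unary.Any using (here)
open import Data.Product using (_×_; _,_; proj₁; proj₂)
open import Data.Sum using (_⊎_; inj₁; inj₂)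
open import Data.Empty using (⊥-elim)
open import Function using (_∘_)
open import Function.Bundles using (_⇔_; mk⇔; Equivalence)
open import Relation.Binary.PropositionalEquality using (refl)

open Lift1
open Equivalence

⊑-refl : ∀ {S} → S ⊑ S
⊑-refl r x = x

⊑-trans : ∀ {S T U} → S ⊑ T → T ⊑ U → S ⊑ U
⊑-trans f g r x = g r (f r x)

AllExt-⊑ : ∀ {S U} {P : System → Set₁} → S ⊑ U → AllExt S P → AllExt U P
AllExt-⊑ s h U' u' = h U' (⊑-trans s u')

Premises : System → List At⊥ → List (List At⊥ × At⊥) → Set
Premises S Δ = All (λ prem → Deriv S (proj₁ prem ++ Δ) (proj₂ prem))

mutual
  Deriv-⊑ : ∀ {S U Δ p} → S ⊑ U → Deriv S Δ p → Deriv U Δ p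
  Deriv-⊑ s (hyp m)       = hyp m
  Deriv-⊑ s (rule r x ds) = rule r (s r x) (Premises-⊑ s ds)

  Premises-⊑ : ∀ {S U Δ ps} → S ⊑ U → Premises S Δ ps → Premises U Δ ps
  Premises-⊑ s []       = []
  Premises-⊑ s (d ∷ ds) = Deriv-⊑ s d ∷ Premises-⊑ s ds

mutual
  Deriv-weaken : ∀ {S Δ Γ p} → Δ ⊆ Γ → Deriv S Δ p → Deriv S Γ p
  Deriv-weaken f (hyp m)       = hyp (f m)
  Deriv-weaken f (rule r x ds) = rule r x (Premises-weaken f ds)

  Premises-weaken : ∀ {S Δ Γ ps} → Δ ⊆ Γ → Premises S Δ ps → Premises S Γ ps
  Premises-weaken f []                          = []
  Premises-weaken {ps = (D , _) ∷ _} f (d ∷ ds) =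
    Deriv-weaken (++⁺ʳ D f) d ∷ Premises-weaken f ds

mutual
  Deriv-subst : ∀ {S Δ Γ p} → (∀ {q} → q ∈ Δ → Deriv S Γ q) →
                Deriv S Δ p → Deriv S Γ p
  Deriv-subst σ (hyp m)       = σ m
  Deriv-subst σ (rule r x ds) = rule r x (Premises-subst σ ds)

  Premises-subst : ∀ {S Δ Γ ps} → (∀ {q} → q ∈ Δ → Deriv S Γ q) →
                   Premises S Δ ps → Premises S Γ ps
  Premises-subst                          σ []       = []
  Premises-subst {S} {Δ} {Γ} {(D , _) ∷ _} σ (d ∷ ds) =
    Deriv-subst lift d ∷ Premises-subst σ ds
    where
    lift : ∀ {q} → q ∈ D ++ Δ → Deriv S (D ++ Γ) q
    lift m with ∈-++⁻ D m
    ... | inj₁ m∈D = hyp (∈-++⁺ˡ m∈D)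
    ... | inj₂ m∈Δ = Deriv-weaken (xs⊆ys++xs Γ D) (σ m∈Δ)

Deriv-cut : ∀ {S p q} → Deriv S [] p → Deriv S (p ∷ []) q → Deriv S [] q
Deriv-cut d = Deriv-subst λ { (here refl) → d }

Complete : System → Set
Complete S = ∀ p → Deriv S [] p ⊎ Deriv S (p ∷ []) ⊥ₐ

module _ {S : System} (complete : Complete S) where

  ExtInvariant : (System → Set₁) → Set₁
  ExtInvariant X = AllExt S (λ U → X S ⇔ X U)

  transfer : ∀ {X} → ExtInvariant X → AllExt S (λ T → AllExt S (λ T' → X T → X T'))
  transfer inv T t cT T' t' cT' = to (inv T' t' cT') ∘ from (inv T t cT)

  atomⁱ-invariant : ∀ p → ExtInvariant (λ T → ⊩ˡ T (at i p))
  atomⁱ-invariant p U s cU = mk⇔ (λ d → lift1 (Deriv-⊑ s (lower1 d))) back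
    where
    back : ⊩ˡ U (at i p) → ⊩ˡ S (at i p)
    back (lift1 d) with complete p
    ... | inj₁ ⊢p   = lift1 ⊢p
    ... | inj₂ p⊢⊥ = ⊥-elim (cU (Deriv-cut d (Deriv-⊑ s p⊢⊥)))

  atomᶜ-invariant : ∀ p → ExtInvariant (λ T → ⊩ˡ T (at c p))
  atomᶜ-invariant p U s cU = mk⇔ forth (λ h → lift1 (lower1 h ∘ Deriv-⊑ s))
    where
    forth : ⊩ˡ S (at c p) → ⊩ˡ U (at c p)
    forth (lift1 p⊬⊥) with complete p
    ... | inj₁ ⊢p   = lift1 (cU ∘ Deriv-cut (Deriv-⊑ s ⊢p))
    ... | inj₂ p⊢⊥ = ⊥-elim (p⊬⊥ p⊢⊥)

  -- The classical clause X^c is the double negation of "some consistent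
  -- extension validates X^i", and that existential is extension-invariant.
  classical-invariant : ∀ {X : System → Set₁} → ExtInvariant X →
    ExtInvariant (λ T → ¬₁ (AllExt T (λ T' → X T' → ⊩ˡ T' ⊥ⁱ)))
  classical-invariant {X} inv U s cU = mk⇔ forth (λ h → h ∘ AllExt-⊑ s)
    where
    forth : ¬₁ (AllExt S (λ T → X T → ⊩ˡ T ⊥ⁱ)) → ¬₁ (AllExt U (λ T → X T → ⊩ˡ T ⊥ⁱ))
    forth h refuteU = h λ T t cT x →
      ⊥-elim (cU (lower1 (refuteU U ⊑-refl cU (transfer inv T t cT U s cU x))))

  ∧-invariant : ∀ {A B} → ExtInvariant (λ T → ⊩ˡ T A) → ExtInvariant (λ T → ⊩ˡ T B) →
                ExtInvariant (λ T → ⊩∧ T A B)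
  ∧-invariant invA invB U s cU =
    mk⇔ (λ (a , b) → to (invA U s cU) a , to (invB U s cU) b)
        (λ (a , b) → from (invA U s cU) a , from (invB U s cU) b)

  -- To prove p at an extension T of S, run the disjunction hypothesis at U and
  -- move every intermediate validity between T and the extensions of U.
  ∨-invariant : ∀ {A B} → ExtInvariant (λ T → ⊩ˡ T A) → ExtInvariant (λ T → ⊩ˡ T B) →
                ExtInvariant (λ T → ⊩∨ T A B)
  ∨-invariant {A} {B} invA invB U s cU = mk⇔ (AllExt-⊑ s) back
    where
    back : ⊩∨ U A B → ⊩∨ S A B
    back h T t cT p A⇒p B⇒p =
      move U s cU T t cT (h U ⊑-refl cU p (via A⇒p invA) (via B⇒p invB))
      where
      move : AllExt S (λ T₁ → AllExt S (λ T₂ → ⊩ˡ T₁ (at i p) → ⊩ˡ T₂ (at i p)))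
      move = transfer (atomⁱ-invariant p)

      via : ∀ {C} → AllExt T (λ T' → ⊩ˡ T' C → ⊩ˡ T' (at i p)) →
            ExtInvariant (λ T' → ⊩ˡ T' C) →
            AllExt U (λ U' → ⊩ˡ U' C → ⊩ˡ U' (at i p))
      via C⇒p invC U' u' cU' =
        move T t cT U' (⊑-trans s u') cU' ∘ C⇒p T ⊑-refl cT ∘
        transfer invC U' (⊑-trans s u') cU' T t cT

  →-invariant : ∀ {A B} → ExtInvariant (λ T → ⊩ˡ T A) → ExtInvariant (λ T → ⊩ˡ T B) →
                ExtInvariant (λ T → ⊩→ T A B)
  →-invariant {A} {B} invA invB U s cU = mk⇔ (AllExt-⊑ s) back
    where
    back : ⊩→ U A B → ⊩→ S A B
    back h T t cT allA T' t' cT' =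
      transfer invB U s cU T' (⊑-trans t t') cT' (h U ⊑-refl cU allAᵁ U ⊑-refl cU)
      where
      allAᵁ : AllExt U (λ U' → ⊩ˡ U' A)
      allAᵁ U' u' cU' = transfer invA T t cT U' (⊑-trans s u') cU' (allA T ⊑-refl cT)

  ⊩ˡ-invariant : ∀ A → ExtInvariant (λ T → ⊩ˡ T A)
  ⊩ˡ-invariant (at i p)     = atomⁱ-invariant p
  ⊩ˡ-invariant (at c p)     = atomᶜ-invariant p
  ⊩ˡ-invariant (conj i A B) = ∧-invariant (⊩ˡ-invariant A) (⊩ˡ-invariant B)
  ⊩ˡ-invariant (disj i A B) = ∨-invariant (⊩ˡ-invariant A) (⊩ˡ-invariant B)
  ⊩ˡ-invariant (imp i A B)  = →-invariant (⊩ˡ-invariant A) (⊩ˡ-invariant B)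
  ⊩ˡ-invariant (conj c A B) =
    classical-invariant (∧-invariant (⊩ˡ-invariant A) (⊩ˡ-invariant B))
  ⊩ˡ-invariant (disj c A B) =
    classical-invariant (∨-invariant (⊩ˡ-invariant A) (⊩ˡ-invariant B))
  ⊩ˡ-invariant (imp c A B)  =
    classical-invariant (→-invariant (⊩ˡ-invariant A) (⊩ˡ-invariant B))

lemma11 : (S : System) → Consistent S →
          (∀ p → Deriv S [] p ⊎ Deriv S (p ∷ []) ⊥ₐ) →
          ∀ S' → S ⊑ S' → Consistent S' →
          ∀ (A : Form) → (⊩ˡ S A → ⊩ˡ S' A) × (⊩ˡ S' A → ⊩ˡ S A)
-- Consistency of S is implied by that of S' and never needed.
lemma11 S _ complete S' s cS' A = to S⇔S' , from S⇔S'
  where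
  S⇔S' : ⊩ˡ S A ⇔ ⊩ˡ S' A
  S⇔S' = ⊩ˡ-invariant complete A S' s cS'
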